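{- Let $K$ be a field of characteristic not $2$ or $3$, let $a_2,a_4,a_6\in K$, and let $K[x_0,y_0]=K[x,y]/(y^2-(x^3+a_2x^2+a_4x+a_6))$. Let $f(x,z)=a_6x^4+a_4x^3z+a_2x^2z^2+xz^3$. Then there is an isomorphism of $K$-algebras $\theta:A_f\to\operatorname{Mat}_2(K[x_0,y_0])$ given by $r\mapsto\begin{pmatrix}-y_0&x_0^2+a_2x_0+a_4\\-x_0&y_0\end{pmatrix}$, $s\mapsto\begin{pmatrix}0&x_0+a_2\\1&0\end{pmatrix}$, $t\mapsto\begin{pmatrix}0&1\\0&0\end{pmatrix}$. Moreover $\theta(\xi)=x_0I_2$ and $\theta(\eta)=y_0I_2$.
   Context: For a binary quartic $f(x,z)=ax^4+bx^3z+cx^2z^2+dxz^3+ez^4\in K[x,z]$, $A_f$ is the associative $K$-algebra generated by $r,s,t$ subject to the relations $r^2=a$, $rs+sr=b$, $rt+tr+s^2=c$, $st+ts=d$, $t^2=e$ (i.e. $(\alpha^2r+\alpha\beta s+\beta^2t)^2=f(\alpha,\beta)$ identically in commuting indeterminates $\alpha,\beta$). The central elements are $\xi=s^2-c$ and $\eta=rst-tsr$. For the given $f$: $a=a_6$, $b=a_4$, $c=a_2$, $d=1$, $e=0$. -}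

module Defs where

open import Level using (Level; _⊔_; suc)
open import Algebra.Bundles using (CommutativeRing)
open import Data.Product using (Σ; _×_; ∃)
open import Relation.Nullary using (¬_)

record Field (c ℓ : Level) : Set (suc (c ⊔ ℓ)) where
  field
    commutativeRing : CommutativeRing c ℓ
  open CommutativeRing commutativeRing public
    using (Carrier; _≈_; _+_; _*_; -_; 0#; 1#)
  field
    1≉0     : ¬ (1# ≈ 0#)
    inverse : ∀ x → ¬ (x ≈ 0#) → Σ Carrier (λ y → (x * y) ≈ 1#)

CharNot2or3 : ∀ {c ℓ} → Field c ℓ → Set ℓ
CharNot2or3 K = ¬ ((1# + 1#) ≈ 0#) × ¬ ((1# + 1# + 1#) ≈ 0#)
  where open Field K

module FreeAlg {c ℓ} (K : Field c ℓ) where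
  open Field K

  infixl 6 _⊕_
  infixl 7 _⊗_

  data Tm (G : Set) : Set c where
    con : Carrier → Tm G
    var : G → Tm G
    _⊕_ : Tm G → Tm G → Tm G
    _⊗_ : Tm G → Tm G → Tm G
    ⊝_  : Tm G → Tm G

  -- the K-algebra presented by generators G and relations R:
  -- the least congruence containing R and the K-algebra axioms.
  -- The quotient Tm G / Cong R is the algebra K⟨G⟩/(R) (as a setoid).
  data Cong {G : Set} {ℓ′ : Level} (R : Tm G → Tm G → Set ℓ′)
       : Tm G → Tm G → Set (c ⊔ ℓ ⊔ ℓ′) where
    rel    : ∀ {u v} → R u v → Cong R u v
    ≈refl  : ∀ {u} → Cong R u u
    ≈sym   : ∀ {u v} → Cong R u v → Cong R v u
    ≈trans : ∀ {u v w} → Cong R u v → Cong R v w → Cong R u w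
    c-⊕-cong : ∀ {u u′ v v′} → Cong R u u′ → Cong R v v′ → Cong R (u ⊕ v) (u′ ⊕ v′)
    c-⊗-cong : ∀ {u u′ v v′} → Cong R u u′ → Cong R v v′ → Cong R (u ⊗ v) (u′ ⊗ v′)
    ⊝-cong : ∀ {u u′} → Cong R u u′ → Cong R (⊝ u) (⊝ u′)
    c-⊕-assoc : ∀ u v w → Cong R ((u ⊕ v) ⊕ w) (u ⊕ (v ⊕ w))
    c-⊕-comm  : ∀ u v → Cong R (u ⊕ v) (v ⊕ u)
    ⊕-idˡ   : ∀ u → Cong R (con 0# ⊕ u) u
    ⊕-invʳ  : ∀ u → Cong R (u ⊕ (⊝ u)) (con 0#)
    c-⊗-assoc : ∀ u v w → Cong R ((u ⊗ v) ⊗ w) (u ⊗ (v ⊗ w))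
    ⊗-idˡ   : ∀ u → Cong R (con 1# ⊗ u) u
    ⊗-idʳ   : ∀ u → Cong R (u ⊗ con 1#) u
    ⊗-distribˡ : ∀ u v w → Cong R (u ⊗ (v ⊕ w)) ((u ⊗ v) ⊕ (u ⊗ w))
    ⊗-distribʳ : ∀ u v w → Cong R ((v ⊕ w) ⊗ u) ((v ⊗ u) ⊕ (w ⊗ u))
    con-cong : ∀ {k l} → k ≈ l → Cong R (con k) (con l)
    con-+    : ∀ k l → Cong R (con (k + l)) (con k ⊕ con l)
    con-*    : ∀ k l → Cong R (con (k * l)) (con k ⊗ con l)
    con-central : ∀ k u → Cong R (con k ⊗ u) (u ⊗ con k)

  -- The algebra A_f for f = a6 x^4 + a4 x^3 z + a2 x^2 z^2 + x z^3
  -- (a = a6, b = a4, c = a2, d = 1, e = 0).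

  data GA : Set where r s t : GA

  R̂ Ŝ T̂ : Tm GA
  R̂ = var r
  Ŝ = var s
  T̂ = var t

  data RelA (a₂ a₄ a₆ : Carrier) : Tm GA → Tm GA → Set c where
    rel-a : RelA a₂ a₄ a₆ (R̂ ⊗ R̂) (con a₆)
    rel-b : RelA a₂ a₄ a₆ (R̂ ⊗ Ŝ ⊕ Ŝ ⊗ R̂) (con a₄)
    rel-c : RelA a₂ a₄ a₆ (R̂ ⊗ T̂ ⊕ T̂ ⊗ R̂ ⊕ Ŝ ⊗ Ŝ) (con a₂)
    rel-d : RelA a₂ a₄ a₆ (Ŝ ⊗ T̂ ⊕ T̂ ⊗ Ŝ) (con 1#)
    rel-e : RelA a₂ a₄ a₆ (T̂ ⊗ T̂) (con 0#)

  _≈A[_,_,_]_ : Tm GA → Carrier → Carrier → Carrier → Tm GA → Set (c ⊔ ℓ)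
  u ≈A[ a₂ , a₄ , a₆ ] v = Cong (RelA a₂ a₄ a₆) u v

  ξ : Carrier → Tm GA
  ξ a₂ = Ŝ ⊗ Ŝ ⊕ ⊝ con a₂

  η : Tm GA
  η = R̂ ⊗ Ŝ ⊗ T̂ ⊕ ⊝ (T̂ ⊗ Ŝ ⊗ R̂)

  data GC : Set where x y : GC

  X̂ Ŷ : Tm GC
  X̂ = var x
  Ŷ = var y

  data RelC (a₂ a₄ a₆ : Carrier) : Tm GC → Tm GC → Set c where
    rel-comm  : ∀ u v → RelC a₂ a₄ a₆ (u ⊗ v) (v ⊗ u)
    rel-curve : RelC a₂ a₄ a₆ (Ŷ ⊗ Ŷ)
                  (X̂ ⊗ X̂ ⊗ X̂ ⊕ con a₂ ⊗ X̂ ⊗ X̂ ⊕ con a₄ ⊗ X̂ ⊕ con a₆)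

  _≈C[_,_,_]_ : Tm GC → Carrier → Carrier → Carrier → Tm GC → Set (c ⊔ ℓ)
  u ≈C[ a₂ , a₄ , a₆ ] v = Cong (RelC a₂ a₄ a₆) u v

  record M2 : Set c where
    constructor mat
    field
      m11 m12 m21 m22 : Tm GC
  open M2 public

  _≈M[_,_,_]_ : M2 → Carrier → Carrier → Carrier → M2 → Set (c ⊔ ℓ)
  A ≈M[ a₂ , a₄ , a₆ ] B =
    (m11 A ≈C[ a₂ , a₄ , a₆ ] m11 B) × (m12 A ≈C[ a₂ , a₄ , a₆ ] m12 B) ×
    (m21 A ≈C[ a₂ , a₄ , a₆ ] m21 B) × (m22 A ≈C[ a₂ , a₄ , a₆ ] m22 B)

  _+M_ : M2 → M2 → M2
  mat a b c′ d +M mat a′ b′ c″ d′ = mat (a ⊕ a′) (b ⊕ b′) (c′ ⊕ c″) (d ⊕ d′)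

  _*M_ : M2 → M2 → M2
  mat a b c′ d *M mat a′ b′ c″ d′ =
    mat (a ⊗ a′ ⊕ b ⊗ c″) (a ⊗ b′ ⊕ b ⊗ d′)
        (c′ ⊗ a′ ⊕ d ⊗ c″) (c′ ⊗ b′ ⊕ d ⊗ d′)

  -M_ : M2 → M2
  -M mat a b c′ d = mat (⊝ a) (⊝ b) (⊝ c′) (⊝ d)

  scal : Tm GC → M2
  scal u = mat u (con 0#) (con 0#) u

  θgen : Carrier → Carrier → GA → M2
  θgen a₂ a₄ r = mat (⊝ Ŷ) (X̂ ⊗ X̂ ⊕ con a₂ ⊗ X̂ ⊕ con a₄) (⊝ X̂) Ŷ
  θgen a₂ a₄ s = mat (con 0#) (X̂ ⊕ con a₂) (con 1#) (con 0#)
  θgen a₂ a₄ t = mat (con 0#) (con 1#) (con 0#) (con 0#)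

  θ : Carrier → Carrier → Tm GA → M2
  θ a₂ a₄ (con k) = scal (con k)
  θ a₂ a₄ (var g) = θgen a₂ a₄ g
  θ a₂ a₄ (u ⊕ v) = θ a₂ a₄ u +M θ a₂ a₄ v
  θ a₂ a₄ (u ⊗ v) = θ a₂ a₄ u *M θ a₂ a₄ v
  θ a₂ a₄ (⊝ u)   = -M (θ a₂ a₄ u)

{-# OPTIONS --safe #-}

-- θ is well defined because θ(r), θ(s), θ(t) satisfy the defining relations of A_f, the
-- relation for r² being exactly y0² = x0³ + a₂x0² + a₄x0 + a₆.  Conversely ξ and η are central
-- in A_f and satisfy η² = ξ³ + a₂ξ² + a₄ξ + a₆, so x0 ↦ ξ, y0 ↦ η defines a homomorphism ι from
-- K[x0,y0] to the centre of A_f.  As θ maps ts, t, sts, st to the four matrix units,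
-- M ↦ Σ ι(M_ij)·(preimage of e_ij) is a two-sided inverse of θ.  The identities in A_f are
-- verified by normalising noncommutative polynomials with central coefficients, reading the
-- defining relations as rewrite rules.

module Submission where

open import Level using (Level; _⊔_)
open import Algebra.Bundles using (Ring)
import Algebra.Properties.CommutativeSemigroup as CommutativeSemigroupProperties
import Algebra.Properties.Group as GroupProperties
import Algebra.Properties.Ring as RingProperties
open import Data.Bool using (Bool; true; false; not; _∧_; _∨_; if_then_else_)
open import Data.Fin using (Fin; toℕ; #_)
import Data.Fin.Properties as Fin
open import Data.List using (List; []; _∷_; _++_; foldr)
import Data.List.Properties as List
open import Data.Maybe using (Maybe; just; nothing)
open import Data.Nat using (ℕ; zero; suc; _<ᵇ_)
open import Data.Product using (Σ; _×_; _,_; proj₁; proj₂)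
import Data.Product.Properties as Product
open import Data.Sign as Sign using (Sign)
open import Data.Vec using (lookup; []; _∷_)
open import Function using (_∘_)
open import Relation.Binary.Definitions using (DecidableEquality)
open import Relation.Binary.PropositionalEquality using (_≡_; refl; cong)
open import Relation.Nullary using (yes; no)
open import Relation.Nullary.Decidable using (map′)

open import Defs

module PresentedRing {c ℓ} (K : Field c ℓ) {G : Set} {ℓ′ : Level}
                     (R : FreeAlg.Tm K G → FreeAlg.Tm K G → Set ℓ′) where
  open Field K using (0#; 1#)
  open FreeAlg K

  infix 4 _≋_
  _≋_ : Tm G → Tm G → Set (c ⊔ ℓ ⊔ ℓ′)
  _≋_ = Cong R

  ring : Ring c (c ⊔ ℓ ⊔ ℓ′)
  ring = record
    { Carrier = Tm G ; _≈_ = _≋_ ; _+_ = _⊕_ ; _*_ = _⊗_ ; -_ = ⊝_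
    ; 0# = con 0# ; 1# = con 1#
    ; isRing = record
      { +-isAbelianGroup = record
        { isGroup = record
          { isMonoid = record
            { isSemigroup = record
              { isMagma = record
                { isEquivalence = record { refl = ≈refl ; sym = ≈sym ; trans = ≈trans }
                ; ∙-cong = c-⊕-cong }
              ; assoc = c-⊕-assoc }
            ; identity = ⊕-idˡ , λ u → ≈trans (c-⊕-comm u (con 0#)) (⊕-idˡ u) }
          ; inverse = (λ u → ≈trans (c-⊕-comm (⊝ u) u) (⊕-invʳ u)) , ⊕-invʳ
          ; ⁻¹-cong = ⊝-cong }
        ; comm = c-⊕-comm }
      ; *-cong = c-⊗-cong
      ; *-assoc = c-⊗-assoc
      ; *-identity = ⊗-idˡ , ⊗-idʳ
      ; distrib = ⊗-distribˡ , ⊗-distribʳ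
      } }

  open Ring ring public using (zeroˡ; zeroʳ; +-identityʳ)
  open RingProperties ring public
    using (-‿involutive; -‿distribˡ-*; -‿distribʳ-*; -‿+-comm; -0#≈0#)
  open GroupProperties (Ring.+-group ring) public
    using (\\-leftDividesˡ; \\-leftDividesʳ)
  open CommutativeSemigroupProperties (Ring.+-commutativeSemigroup ring) public
    using (x∙yz≈y∙xz)
  open import Relation.Binary.Reasoning.Setoid (Ring.setoid ring) public

  Commute : Tm G → Tm G → Set (c ⊔ ℓ ⊔ ℓ′)
  Commute z u = z ⊗ u ≋ u ⊗ z

  Central : Tm G → Set (c ⊔ ℓ ⊔ ℓ′)
  Central z = ∀ u → Commute z u

  module _ {z : Tm G} where

    commute-⊕ : ∀ {u v} → Commute z u → Commute z v → Commute z (u ⊕ v)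
    commute-⊕ {u} {v} zu zv = begin
      z ⊗ (u ⊕ v)    ≈⟨ ⊗-distribˡ _ _ _ ⟩
      z ⊗ u ⊕ z ⊗ v  ≈⟨ c-⊕-cong zu zv ⟩
      u ⊗ z ⊕ v ⊗ z  ≈⟨ ≈sym (⊗-distribʳ _ _ _) ⟩
      (u ⊕ v) ⊗ z    ∎

    commute-⊗ : ∀ {u v} → Commute z u → Commute z v → Commute z (u ⊗ v)
    commute-⊗ {u} {v} zu zv = begin
      z ⊗ (u ⊗ v)  ≈⟨ ≈sym (c-⊗-assoc _ _ _) ⟩
      (z ⊗ u) ⊗ v  ≈⟨ c-⊗-cong zu ≈refl ⟩
      (u ⊗ z) ⊗ v  ≈⟨ c-⊗-assoc _ _ _ ⟩
      u ⊗ (z ⊗ v)  ≈⟨ c-⊗-cong ≈refl zv ⟩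
      u ⊗ (v ⊗ z)  ≈⟨ ≈sym (c-⊗-assoc _ _ _) ⟩
      (u ⊗ v) ⊗ z  ∎

    commute-⊝ : ∀ {u} → Commute z u → Commute z (⊝ u)
    commute-⊝ {u} zu = begin
      z ⊗ (⊝ u)  ≈⟨ ≈sym (-‿distribʳ-* _ _) ⟩
      ⊝ (z ⊗ u)  ≈⟨ ⊝-cong zu ⟩
      ⊝ (u ⊗ z)  ≈⟨ -‿distribˡ-* _ _ ⟩
      (⊝ u) ⊗ z  ∎

    Central-byGenerators : (∀ g → Commute z (var g)) → Central z
    Central-byGenerators zg (con k) = ≈sym (con-central k z)
    Central-byGenerators zg (var g) = zg g
    Central-byGenerators zg (u ⊕ v) =
      commute-⊕ (Central-byGenerators zg u) (Central-byGenerators zg v)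
    Central-byGenerators zg (u ⊗ v) =
      commute-⊗ (Central-byGenerators zg u) (Central-byGenerators zg v)
    Central-byGenerators zg (⊝ u) = commute-⊝ (Central-byGenerators zg u)

  Central-⊕ : ∀ {z z′} → Central z → Central z′ → Central (z ⊕ z′)
  Central-⊕ cz cz′ u = ≈sym (commute-⊕ (≈sym (cz u)) (≈sym (cz′ u)))

  Central-⊗ : ∀ {z z′} → Central z → Central z′ → Central (z ⊗ z′)
  Central-⊗ cz cz′ u = ≈sym (commute-⊗ (≈sym (cz u)) (≈sym (cz′ u)))

  Central-⊝ : ∀ {z} → Central z → Central (⊝ z)
  Central-⊝ cz u = ≈sym (commute-⊝ (≈sym (cz u)))

module Normaliser {c ℓ} (K : Field c ℓ)
    {G : Set} (_≟G_ : DecidableEquality G) (rankG : G → ℕ)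
    {d : ℕ} (coefficient : Fin d → Field.Carrier K)
    {ℓ′ : Level} (R : FreeAlg.Tm K G → FreeAlg.Tm K G → Set ℓ′) where
  open Field K using (0#; 1#)
  open FreeAlg K
  open PresentedRing K R

  data Atom (m : ℕ) : Set where
    coeff : Fin d → Atom m
    cvar  : Fin m → Atom m

  _≟A_ : ∀ {m} → DecidableEquality (Atom m)
  coeff k ≟A coeff k′ = map′ (cong coeff) (λ { refl → refl }) (k Fin.≟ k′)
  coeff _ ≟A cvar _   = no (λ ())
  cvar _  ≟A coeff _  = no (λ ())
  cvar i  ≟A cvar j   = map′ (cong cvar) (λ { refl → refl }) (i Fin.≟ j)

  _<A_ : ∀ {m} → Atom m → Atom m → Bool
  coeff k <A coeff k′ = toℕ k <ᵇ toℕ k′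
  coeff _ <A cvar _   = true
  cvar _  <A coeff _  = false
  cvar i  <A cvar j   = toℕ i <ᵇ toℕ j

  _<G_ : G → G → Bool
  g <G h = rankG g <ᵇ rankG h

  lex : ∀ {X : Set} → (X → X → Bool) → List X → List X → Bool
  lex _<_ []       []       = false
  lex _<_ []       (_ ∷ _)  = true
  lex _<_ (_ ∷ _)  []       = false
  lex _<_ (a ∷ as) (b ∷ bs) = a < b ∨ (not (b < a) ∧ lex _<_ as bs)

  -- A sorted product of central atoms times a word in the generators.
  -- Words are stored reversed: the head of the list is the rightmost letter.
  Monomial : ℕ → Set
  Monomial m = List (Atom m) × List G

  Term : ℕ → Set
  Term m = Sign × Monomial m

  Poly : ℕ → Set
  Poly m = List (Term m)

  _≟M_ : ∀ {m} → DecidableEquality (Monomial m)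
  _≟M_ = Product.≡-dec (List.≡-dec _≟A_) (List.≡-dec _≟G_)

  _<M_ : ∀ {m} → Monomial m → Monomial m → Bool
  (as , w) <M (bs , v) = lex _<A_ as bs ∨ (not (lex _<A_ bs as) ∧ lex _<G_ w v)

  insertAtom : ∀ {m} → Atom m → List (Atom m) → List (Atom m)
  insertAtom a []       = a ∷ []
  insertAtom a (b ∷ as) = if b <A a then b ∷ insertAtom a as else a ∷ b ∷ as

  mergeAtoms : ∀ {m} → List (Atom m) → List (Atom m) → List (Atom m)
  mergeAtoms as bs = foldr insertAtom bs as

  scale : ∀ {m} → Sign → List (Atom m) → Poly m → Poly m
  scale ε as []                  = []
  scale ε as ((ε′ , bs , w) ∷ p) = (ε Sign.* ε′ , mergeAtoms as bs , w) ∷ scale ε as p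

  combine : ∀ {m} → Sign → Sign → Monomial m → Poly m → Poly m
  combine Sign.+ Sign.- μ p = p
  combine Sign.- Sign.+ μ p = p
  combine Sign.+ Sign.+ μ p = (Sign.+ , μ) ∷ (Sign.+ , μ) ∷ p
  combine Sign.- Sign.- μ p = (Sign.- , μ) ∷ (Sign.- , μ) ∷ p

  insert : ∀ {m} → Term m → Poly m → Poly m
  insert τ [] = τ ∷ []
  insert (ε , μ) ((ε′ , μ′) ∷ p) with μ ≟M μ′
  ... | yes refl = combine ε ε′ μ p
  ... | no _     = if μ <M μ′ then (ε , μ) ∷ (ε′ , μ′) ∷ p
                                else (ε′ , μ′) ∷ insert (ε , μ) p

  word : ∀ {m} → List G → Poly m
  word w = (Sign.+ , [] , w) ∷ []

  sort : ∀ {m} → Poly m → Poly m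
  sort = foldr insert []

  infixl 6 _‵+_
  infixl 7 _‵*_
  infix  8 ‵-_

  data Expr (m : ℕ) : Set where
    gen       : G → Expr m
    atom      : Atom m → Expr m
    ‵0 ‵1     : Expr m
    _‵+_ _‵*_ : Expr m → Expr m → Expr m
    ‵-_       : Expr m → Expr m

  signed : Sign → Tm G → Tm G
  signed Sign.+ u = u
  signed Sign.- u = ⊝ u

  module Semantics {m : ℕ} (σ : Fin m → Tm G) where
    ⟦_⟧a : Atom m → Tm G
    ⟦ coeff k ⟧a = con (coefficient k)
    ⟦ cvar i ⟧a  = σ i

    ⟦_⟧as : List (Atom m) → Tm G
    ⟦ [] ⟧as     = con 1#
    ⟦ a ∷ as ⟧as = ⟦ a ⟧a ⊗ ⟦ as ⟧as

    ⟦_⟧w : List G → Tm G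
    ⟦ [] ⟧w    = con 1#
    ⟦ g ∷ w ⟧w = ⟦ w ⟧w ⊗ var g

    ⟦_⟧t : Term m → Tm G
    ⟦ ε , as , w ⟧t = signed ε (⟦ as ⟧as ⊗ ⟦ w ⟧w)

    ⟦_⟧p : Poly m → Tm G
    ⟦ [] ⟧p    = con 0#
    ⟦ τ ∷ p ⟧p = ⟦ τ ⟧t ⊕ ⟦ p ⟧p

    ⟦_⟧ : Expr m → Tm G
    ⟦ gen g ⟧   = var g
    ⟦ atom a ⟧  = ⟦ a ⟧a
    ⟦ ‵0 ⟧      = con 0#
    ⟦ ‵1 ⟧      = con 1#
    ⟦ e ‵+ e′ ⟧ = ⟦ e ⟧ ⊕ ⟦ e′ ⟧
    ⟦ e ‵* e′ ⟧ = ⟦ e ⟧ ⊗ ⟦ e′ ⟧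
    ⟦ ‵- e ⟧    = ⊝ ⟦ e ⟧

  noVariables : Fin 0 → Tm G
  noVariables ()

  signed-cong : ∀ ε {u v} → u ≋ v → signed ε u ≋ signed ε v
  signed-cong Sign.+ u≋v = u≋v
  signed-cong Sign.- u≋v = ⊝-cong u≋v

  signed-* : ∀ ε ε′ u → signed (ε Sign.* ε′) u ≋ signed ε (signed ε′ u)
  signed-* Sign.+ ε′     u = ≈refl
  signed-* Sign.- Sign.+ u = ≈refl
  signed-* Sign.- Sign.- u = ≈sym (-‿involutive u)

  signed-⊗ˡ : ∀ ε u v → signed ε u ⊗ v ≋ signed ε (u ⊗ v)
  signed-⊗ˡ Sign.+ u v = ≈refl
  signed-⊗ˡ Sign.- u v = ≈sym (-‿distribˡ-* u v)

  signed-⊗ʳ : ∀ ε u v → u ⊗ signed ε v ≋ signed ε (u ⊗ v)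
  signed-⊗ʳ Sign.+ u v = ≈refl
  signed-⊗ʳ Sign.- u v = ≈sym (-‿distribʳ-* u v)

  signed-⊕ : ∀ ε u v → signed ε (u ⊕ v) ≋ signed ε u ⊕ signed ε v
  signed-⊕ Sign.+ u v = ≈refl
  signed-⊕ Sign.- u v = ≈sym (-‿+-comm u v)

  signed-0 : ∀ ε → signed ε (con 0#) ≋ con 0#
  signed-0 Sign.+ = ≈refl
  signed-0 Sign.- = -0#≈0#

  module Soundness {m : ℕ} (σ : Fin m → Tm G) (σ-central : ∀ i → Central (σ i)) where
    open Semantics σ

    atom-central : ∀ a → Central ⟦ a ⟧a
    atom-central (coeff k) = con-central (coefficient k)
    atom-central (cvar i)  = σ-central i

    atoms-central : ∀ as → Central ⟦ as ⟧as
    atoms-central []       = con-central 1#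
    atoms-central (a ∷ as) = Central-⊗ (atom-central a) (atoms-central as)

    insertAtom-sound : ∀ a as → ⟦ insertAtom a as ⟧as ≋ ⟦ a ⟧a ⊗ ⟦ as ⟧as
    insertAtom-sound a []       = ≈refl
    insertAtom-sound a (b ∷ as) with b <A a
    ... | true  = begin
      ⟦ b ⟧a ⊗ ⟦ insertAtom a as ⟧as  ≈⟨ c-⊗-cong ≈refl (insertAtom-sound a as) ⟩
      ⟦ b ⟧a ⊗ (⟦ a ⟧a ⊗ ⟦ as ⟧as)    ≈⟨ ≈sym (c-⊗-assoc _ _ _) ⟩
      (⟦ b ⟧a ⊗ ⟦ a ⟧a) ⊗ ⟦ as ⟧as    ≈⟨ c-⊗-cong (atom-central b _) ≈refl ⟩
      (⟦ a ⟧a ⊗ ⟦ b ⟧a) ⊗ ⟦ as ⟧as    ≈⟨ c-⊗-assoc _ _ _ ⟩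
      ⟦ a ⟧a ⊗ (⟦ b ⟧a ⊗ ⟦ as ⟧as)    ∎
    ... | false = ≈refl

    mergeAtoms-sound : ∀ as bs → ⟦ mergeAtoms as bs ⟧as ≋ ⟦ as ⟧as ⊗ ⟦ bs ⟧as
    mergeAtoms-sound []       bs = ≈sym (⊗-idˡ _)
    mergeAtoms-sound (a ∷ as) bs = begin
      ⟦ insertAtom a (mergeAtoms as bs) ⟧as  ≈⟨ insertAtom-sound a _ ⟩
      ⟦ a ⟧a ⊗ ⟦ mergeAtoms as bs ⟧as        ≈⟨ c-⊗-cong ≈refl (mergeAtoms-sound as bs) ⟩
      ⟦ a ⟧a ⊗ (⟦ as ⟧as ⊗ ⟦ bs ⟧as)         ≈⟨ ≈sym (c-⊗-assoc _ _ _) ⟩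
      (⟦ a ⟧a ⊗ ⟦ as ⟧as) ⊗ ⟦ bs ⟧as         ∎

    signed-atoms-shift : ∀ ε as u v →
                         signed ε (⟦ as ⟧as ⊗ (u ⊗ v)) ≋ u ⊗ signed ε (⟦ as ⟧as ⊗ v)
    signed-atoms-shift ε as u v = begin
      signed ε (⟦ as ⟧as ⊗ (u ⊗ v))  ≈⟨ signed-cong ε (≈sym (c-⊗-assoc _ _ _)) ⟩
      signed ε ((⟦ as ⟧as ⊗ u) ⊗ v)  ≈⟨ signed-cong ε (c-⊗-cong (atoms-central as u) ≈refl) ⟩
      signed ε ((u ⊗ ⟦ as ⟧as) ⊗ v)  ≈⟨ signed-cong ε (c-⊗-assoc _ _ _) ⟩
      signed ε (u ⊗ (⟦ as ⟧as ⊗ v))  ≈⟨ ≈sym (signed-⊗ʳ ε _ _) ⟩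
      u ⊗ signed ε (⟦ as ⟧as ⊗ v)    ∎

    scale-sound : ∀ ε as p → ⟦ scale ε as p ⟧p ≋ signed ε (⟦ as ⟧as ⊗ ⟦ p ⟧p)
    scale-sound ε as []                  = ≈sym (≈trans (signed-cong ε (zeroʳ _)) (signed-0 ε))
    scale-sound ε as ((ε′ , bs , w) ∷ p) = begin
      signed (ε Sign.* ε′) (⟦ mergeAtoms as bs ⟧as ⊗ ⟦ w ⟧w) ⊕ ⟦ scale ε as p ⟧p
        ≈⟨ c-⊕-cong term (scale-sound ε as p) ⟩
      signed ε (⟦ as ⟧as ⊗ ⟦ ε′ , bs , w ⟧t) ⊕ signed ε (⟦ as ⟧as ⊗ ⟦ p ⟧p)
        ≈⟨ ≈sym (signed-⊕ ε _ _) ⟩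
      signed ε (⟦ as ⟧as ⊗ ⟦ ε′ , bs , w ⟧t ⊕ ⟦ as ⟧as ⊗ ⟦ p ⟧p)
        ≈⟨ signed-cong ε (≈sym (⊗-distribˡ _ _ _)) ⟩
      signed ε (⟦ as ⟧as ⊗ (⟦ ε′ , bs , w ⟧t ⊕ ⟦ p ⟧p)) ∎
      where
      term : signed (ε Sign.* ε′) (⟦ mergeAtoms as bs ⟧as ⊗ ⟦ w ⟧w)
             ≋ signed ε (⟦ as ⟧as ⊗ ⟦ ε′ , bs , w ⟧t)
      term = begin
        signed (ε Sign.* ε′) (⟦ mergeAtoms as bs ⟧as ⊗ ⟦ w ⟧w)
          ≈⟨ signed-* ε ε′ _ ⟩
        signed ε (signed ε′ (⟦ mergeAtoms as bs ⟧as ⊗ ⟦ w ⟧w))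
          ≈⟨ signed-cong ε (signed-cong ε′ (c-⊗-cong (mergeAtoms-sound as bs) ≈refl)) ⟩
        signed ε (signed ε′ ((⟦ as ⟧as ⊗ ⟦ bs ⟧as) ⊗ ⟦ w ⟧w))
          ≈⟨ signed-cong ε (signed-cong ε′ (c-⊗-assoc _ _ _)) ⟩
        signed ε (signed ε′ (⟦ as ⟧as ⊗ (⟦ bs ⟧as ⊗ ⟦ w ⟧w)))
          ≈⟨ signed-cong ε (≈sym (signed-⊗ʳ ε′ _ _)) ⟩
        signed ε (⟦ as ⟧as ⊗ ⟦ ε′ , bs , w ⟧t) ∎

    ++-sound : ∀ p q → ⟦ p ++ q ⟧p ≋ ⟦ p ⟧p ⊕ ⟦ q ⟧p
    ++-sound []      q = ≈sym (⊕-idˡ _)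
    ++-sound (τ ∷ p) q = ≈trans (c-⊕-cong ≈refl (++-sound p q)) (≈sym (c-⊕-assoc _ _ _))

    combine-sound : ∀ ε ε′ μ p →
                    ⟦ combine ε ε′ μ p ⟧p ≋ ⟦ ε , μ ⟧t ⊕ (⟦ ε′ , μ ⟧t ⊕ ⟦ p ⟧p)
    combine-sound Sign.+ Sign.- μ p = ≈sym (\\-leftDividesˡ _ _)
    combine-sound Sign.- Sign.+ μ p = ≈sym (\\-leftDividesʳ _ _)
    combine-sound Sign.+ Sign.+ μ p = ≈refl
    combine-sound Sign.- Sign.- μ p = ≈refl

    insert-sound : ∀ τ p → ⟦ insert τ p ⟧p ≋ ⟦ τ ⟧t ⊕ ⟦ p ⟧p
    insert-sound τ [] = ≈refl
    insert-sound (ε , μ) ((ε′ , μ′) ∷ p) with μ ≟M μ′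
    ... | yes refl = combine-sound ε ε′ μ p
    ... | no _ with μ <M μ′
    ...   | true  = ≈refl
    ...   | false = ≈trans (c-⊕-cong ≈refl (insert-sound (ε , μ) p)) (x∙yz≈y∙xz _ _ _)

    sort-sound : ∀ p → ⟦ sort p ⟧p ≋ ⟦ p ⟧p
    sort-sound []      = ≈refl
    sort-sound (τ ∷ p) = ≈trans (insert-sound τ (sort p)) (c-⊕-cong ≈refl (sort-sound p))

    word-sound : ∀ w → ⟦ word w ⟧p ≋ ⟦ w ⟧w
    word-sound w = ≈trans (+-identityʳ _) (⊗-idˡ _)

  Rules : Set
  Rules = ∀ {m} → G → G → Maybe (Poly m)

  SoundRules : Rules → Set (c ⊔ ℓ ⊔ ℓ′)
  SoundRules rule = ∀ {m} (σ : Fin m → Tm G) → (∀ i → Central (σ i)) →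
                    ∀ h g P → rule h g ≡ just P → Semantics.⟦_⟧p σ P ≋ var h ⊗ var g

  module Reduction (rule : Rules) where

    -- Rewriting need not terminate, so it is bounded by fuel; running out of
    -- fuel merely leaves a product unreduced.
    mutual
      word*gen : ∀ {m} → ℕ → List G → G → Poly m
      word*gen zero    w       g = word (g ∷ w)
      word*gen (suc n) []      g = word (g ∷ [])
      word*gen (suc n) (h ∷ w) g = reduce n w h g (rule h g)

      reduce : ∀ {m} → ℕ → List G → G → G → Maybe (Poly m) → Poly m
      reduce n w h g nothing  = word (g ∷ h ∷ w)
      reduce n w h g (just P) = word*poly n w P

      word*poly : ∀ {m} → ℕ → List G → Poly m → Poly m
      word*poly n w []                  = []
      word*poly n w ((ε , as , v) ∷ P) =
        scale ε as (poly*word n (word w) v) ++ word*poly n w P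

      poly*word : ∀ {m} → ℕ → Poly m → List G → Poly m
      poly*word n p []      = p
      poly*word n p (g ∷ v) = poly*gen n (poly*word n p v) g

      poly*gen : ∀ {m} → ℕ → Poly m → G → Poly m
      poly*gen n []                  g = []
      poly*gen n ((ε , as , w) ∷ p) g = scale ε as (word*gen n w g) ++ poly*gen n p g

    poly*poly : ∀ {m} → ℕ → Poly m → Poly m → Poly m
    poly*poly n p []                  = []
    poly*poly n p ((ε , as , v) ∷ q) = scale ε as (poly*word n p v) ++ poly*poly n p q

    fuel : ℕ
    fuel = 40

    normalise : ∀ {m} → Expr m → Poly m
    normalise (gen g)   = word (g ∷ [])
    normalise (atom a)  = (Sign.+ , a ∷ [] , []) ∷ []
    normalise ‵0        = []
    normalise ‵1        = word []
    normalise (e ‵+ e′) = sort (normalise e ++ normalise e′)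
    normalise (e ‵* e′) = sort (poly*poly fuel (normalise e) (normalise e′))
    normalise (‵- e)    = sort (scale Sign.- [] (normalise e))

    module _ (rule-sound : SoundRules rule)
             {m : ℕ} (σ : Fin m → Tm G) (σ-central : ∀ i → Central (σ i)) where
      open Semantics σ
      open Soundness σ σ-central

      mutual
        word*gen-sound : ∀ n w g → ⟦ word*gen {m} n w g ⟧p ≋ ⟦ w ⟧w ⊗ var g
        word*gen-sound zero    w       g = word-sound (g ∷ w)
        word*gen-sound (suc n) []      g = word-sound (g ∷ [])
        word*gen-sound (suc n) (h ∷ w) g with rule {m} h g in eq
        ... | nothing = word-sound (g ∷ h ∷ w)
        ... | just P  = begin
          ⟦ word*poly n w P ⟧p      ≈⟨ word*poly-sound n w P ⟩
          ⟦ w ⟧w ⊗ ⟦ P ⟧p           ≈⟨ c-⊗-cong ≈refl (rule-sound σ σ-central h g P eq) ⟩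
          ⟦ w ⟧w ⊗ (var h ⊗ var g)  ≈⟨ ≈sym (c-⊗-assoc _ _ _) ⟩
          (⟦ w ⟧w ⊗ var h) ⊗ var g  ∎

        word*poly-sound : ∀ n w P → ⟦ word*poly {m} n w P ⟧p ≋ ⟦ w ⟧w ⊗ ⟦ P ⟧p
        word*poly-sound n w []                  = ≈sym (zeroʳ _)
        word*poly-sound n w ((ε , as , v) ∷ P) = begin
          ⟦ scale ε as (poly*word n (word w) v) ++ word*poly n w P ⟧p
            ≈⟨ ++-sound _ _ ⟩
          ⟦ scale ε as (poly*word n (word w) v) ⟧p ⊕ ⟦ word*poly n w P ⟧p
            ≈⟨ c-⊕-cong (scale-sound ε as _) (word*poly-sound n w P) ⟩
          signed ε (⟦ as ⟧as ⊗ ⟦ poly*word n (word w) v ⟧p) ⊕ ⟦ w ⟧w ⊗ ⟦ P ⟧p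
            ≈⟨ c-⊕-cong (signed-cong ε (c-⊗-cong ≈refl
                 (≈trans (poly*word-sound n _ v) (c-⊗-cong (word-sound w) ≈refl)))) ≈refl ⟩
          signed ε (⟦ as ⟧as ⊗ (⟦ w ⟧w ⊗ ⟦ v ⟧w)) ⊕ ⟦ w ⟧w ⊗ ⟦ P ⟧p
            ≈⟨ c-⊕-cong (signed-atoms-shift ε as _ _) ≈refl ⟩
          ⟦ w ⟧w ⊗ ⟦ ε , as , v ⟧t ⊕ ⟦ w ⟧w ⊗ ⟦ P ⟧p
            ≈⟨ ≈sym (⊗-distribˡ _ _ _) ⟩
          ⟦ w ⟧w ⊗ (⟦ ε , as , v ⟧t ⊕ ⟦ P ⟧p) ∎

        poly*word-sound : ∀ n p v → ⟦ poly*word {m} n p v ⟧p ≋ ⟦ p ⟧p ⊗ ⟦ v ⟧w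
        poly*word-sound n p []      = ≈sym (⊗-idʳ _)
        poly*word-sound n p (g ∷ v) = begin
          ⟦ poly*gen n (poly*word n p v) g ⟧p  ≈⟨ poly*gen-sound n _ g ⟩
          ⟦ poly*word n p v ⟧p ⊗ var g         ≈⟨ c-⊗-cong (poly*word-sound n p v) ≈refl ⟩
          (⟦ p ⟧p ⊗ ⟦ v ⟧w) ⊗ var g            ≈⟨ c-⊗-assoc _ _ _ ⟩
          ⟦ p ⟧p ⊗ (⟦ v ⟧w ⊗ var g)            ∎

        poly*gen-sound : ∀ n p g → ⟦ poly*gen {m} n p g ⟧p ≋ ⟦ p ⟧p ⊗ var g
        poly*gen-sound n []                  g = ≈sym (zeroˡ _)
        poly*gen-sound n ((ε , as , w) ∷ p) g = begin
          ⟦ scale ε as (word*gen n w g) ++ poly*gen n p g ⟧p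
            ≈⟨ ++-sound _ _ ⟩
          ⟦ scale ε as (word*gen n w g) ⟧p ⊕ ⟦ poly*gen n p g ⟧p
            ≈⟨ c-⊕-cong (scale-sound ε as _) (poly*gen-sound n p g) ⟩
          signed ε (⟦ as ⟧as ⊗ ⟦ word*gen n w g ⟧p) ⊕ ⟦ p ⟧p ⊗ var g
            ≈⟨ c-⊕-cong (signed-cong ε (c-⊗-cong ≈refl (word*gen-sound n w g))) ≈refl ⟩
          signed ε (⟦ as ⟧as ⊗ (⟦ w ⟧w ⊗ var g)) ⊕ ⟦ p ⟧p ⊗ var g
            ≈⟨ c-⊕-cong (signed-cong ε (≈sym (c-⊗-assoc _ _ _))) ≈refl ⟩
          signed ε ((⟦ as ⟧as ⊗ ⟦ w ⟧w) ⊗ var g) ⊕ ⟦ p ⟧p ⊗ var g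
            ≈⟨ c-⊕-cong (≈sym (signed-⊗ˡ ε _ _)) ≈refl ⟩
          ⟦ ε , as , w ⟧t ⊗ var g ⊕ ⟦ p ⟧p ⊗ var g
            ≈⟨ ≈sym (⊗-distribʳ _ _ _) ⟩
          (⟦ ε , as , w ⟧t ⊕ ⟦ p ⟧p) ⊗ var g ∎

      poly*poly-sound : ∀ n p q → ⟦ poly*poly {m} n p q ⟧p ≋ ⟦ p ⟧p ⊗ ⟦ q ⟧p
      poly*poly-sound n p []                  = ≈sym (zeroʳ _)
      poly*poly-sound n p ((ε , as , v) ∷ q) = begin
        ⟦ scale ε as (poly*word n p v) ++ poly*poly n p q ⟧p
          ≈⟨ ++-sound _ _ ⟩
        ⟦ scale ε as (poly*word n p v) ⟧p ⊕ ⟦ poly*poly n p q ⟧p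
          ≈⟨ c-⊕-cong (scale-sound ε as _) (poly*poly-sound n p q) ⟩
        signed ε (⟦ as ⟧as ⊗ ⟦ poly*word n p v ⟧p) ⊕ ⟦ p ⟧p ⊗ ⟦ q ⟧p
          ≈⟨ c-⊕-cong (signed-cong ε (c-⊗-cong ≈refl (poly*word-sound n p v))) ≈refl ⟩
        signed ε (⟦ as ⟧as ⊗ (⟦ p ⟧p ⊗ ⟦ v ⟧w)) ⊕ ⟦ p ⟧p ⊗ ⟦ q ⟧p
          ≈⟨ c-⊕-cong (signed-atoms-shift ε as _ _) ≈refl ⟩
        ⟦ p ⟧p ⊗ ⟦ ε , as , v ⟧t ⊕ ⟦ p ⟧p ⊗ ⟦ q ⟧p
          ≈⟨ ≈sym (⊗-distribˡ _ _ _) ⟩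
        ⟦ p ⟧p ⊗ (⟦ ε , as , v ⟧t ⊕ ⟦ q ⟧p) ∎

      normalise-sound : ∀ e → ⟦ normalise e ⟧p ≋ ⟦ e ⟧
      normalise-sound (gen g)   = ≈trans (word-sound (g ∷ [])) (⊗-idˡ _)
      normalise-sound (atom a)  = ≈trans (+-identityʳ _) (≈trans (⊗-idʳ _) (⊗-idʳ _))
      normalise-sound ‵0        = ≈refl
      normalise-sound ‵1        = word-sound []
      normalise-sound (e ‵+ e′) = ≈trans (sort-sound _)
        (≈trans (++-sound _ _) (c-⊕-cong (normalise-sound e) (normalise-sound e′)))
      normalise-sound (e ‵* e′) = ≈trans (sort-sound _)
        (≈trans (poly*poly-sound fuel _ _) (c-⊗-cong (normalise-sound e) (normalise-sound e′)))
      normalise-sound (‵- e)    = ≈trans (sort-sound _)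
        (≈trans (scale-sound Sign.- [] _) (⊝-cong (≈trans (⊗-idˡ _) (normalise-sound e))))

      solve : ∀ e e′ → normalise e ≡ normalise e′ → ⟦ e ⟧ ≋ ⟦ e′ ⟧
      solve e e′ eq = begin
        ⟦ e ⟧                ≈⟨ normalise-sound e ⟨
        ⟦ normalise e ⟧p     ≡⟨ cong ⟦_⟧p eq ⟩
        ⟦ normalise e′ ⟧p    ≈⟨ normalise-sound e′ ⟩
        ⟦ e′ ⟧               ∎

  module Free = Reduction (λ _ _ → nothing)

  free-sound : SoundRules (λ _ _ → nothing)
  free-sound σ _ h g P ()

module Isomorphism {c ℓ} (K : Field c ℓ) (a₂ a₄ a₆ : Field.Carrier K) where
  open Field K using (Carrier; 0#; 1#)
  open FreeAlg K

  coefficient : Fin 3 → Carrier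
  coefficient = lookup (a₂ ∷ a₄ ∷ a₆ ∷ [])

  module Af where
    open PresentedRing K (RelA a₂ a₄ a₆) public

    _≟_ : DecidableEquality GA
    r ≟ r = yes refl
    r ≟ s = no (λ ())
    r ≟ t = no (λ ())
    s ≟ r = no (λ ())
    s ≟ s = yes refl
    s ≟ t = no (λ ())
    t ≟ r = no (λ ())
    t ≟ s = no (λ ())
    t ≟ t = yes refl

    rank : GA → ℕ
    rank r = 0
    rank s = 1
    rank t = 2

    open Normaliser K _≟_ rank coefficient (RelA a₂ a₄ a₆) public

    ‵a₂ ‵a₄ ‵a₆ ‵r ‵s ‵t ‵ξ ‵η : ∀ {m} → Expr m
    ‵a₂ = atom (coeff (# 0))
    ‵a₄ = atom (coeff (# 1))
    ‵a₆ = atom (coeff (# 2))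
    ‵r  = gen r
    ‵s  = gen s
    ‵t  = gen t
    ‵ξ  = ‵s ‵* ‵s ‵+ ‵- ‵a₂
    ‵η  = ‵r ‵* ‵s ‵* ‵t ‵+ ‵- (‵t ‵* ‵s ‵* ‵r)

    relations : Rules
    relations t t = just []
    relations t s = just (Free.normalise (‵1 ‵+ ‵- (‵s ‵* ‵t)))
    relations r r = just (Free.normalise ‵a₆)
    relations r s = just (Free.normalise (‵a₄ ‵+ ‵- (‵s ‵* ‵r)))
    relations t r = just (Free.normalise (‵a₂ ‵+ ‵- (‵r ‵* ‵t) ‵+ ‵- (‵s ‵* ‵s)))
    relations _ _ = nothing

    relations-sound : SoundRules relations
    relations-sound σ σc t t _ refl = ≈sym (rel rel-e)
    relations-sound σ σc t s _ refl = begin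
      ⟦ Free.normalise (‵1 ‵+ ‵- (‵s ‵* ‵t)) ⟧p
        ≈⟨ Free.normalise-sound free-sound σ σc (‵1 ‵+ ‵- (‵s ‵* ‵t)) ⟩
      con 1# ⊕ ⊝ (var s ⊗ var t)
        ≈⟨ c-⊕-cong (≈sym (rel rel-d)) ≈refl ⟩
      (var s ⊗ var t ⊕ var t ⊗ var s) ⊕ ⊝ (var s ⊗ var t)
        ≈⟨ Free.solve free-sound σ σc ((‵s ‵* ‵t ‵+ ‵t ‵* ‵s) ‵+ ‵- (‵s ‵* ‵t)) (‵t ‵* ‵s) refl ⟩
      var t ⊗ var s ∎
      where open Semantics σ
    relations-sound σ σc r r _ refl =
      ≈trans (Free.normalise-sound free-sound σ σc ‵a₆) (≈sym (rel rel-a))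
    relations-sound σ σc r s _ refl = begin
      ⟦ Free.normalise (‵a₄ ‵+ ‵- (‵s ‵* ‵r)) ⟧p
        ≈⟨ Free.normalise-sound free-sound σ σc (‵a₄ ‵+ ‵- (‵s ‵* ‵r)) ⟩
      con a₄ ⊕ ⊝ (var s ⊗ var r)
        ≈⟨ c-⊕-cong (≈sym (rel rel-b)) ≈refl ⟩
      (var r ⊗ var s ⊕ var s ⊗ var r) ⊕ ⊝ (var s ⊗ var r)
        ≈⟨ Free.solve free-sound σ σc ((‵r ‵* ‵s ‵+ ‵s ‵* ‵r) ‵+ ‵- (‵s ‵* ‵r)) (‵r ‵* ‵s) refl ⟩
      var r ⊗ var s ∎
      where open Semantics σ
    relations-sound σ σc t r _ refl = begin
      ⟦ Free.normalise (‵a₂ ‵+ ‵- (‵r ‵* ‵t) ‵+ ‵- (‵s ‵* ‵s)) ⟧p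
        ≈⟨ Free.normalise-sound free-sound σ σc (‵a₂ ‵+ ‵- (‵r ‵* ‵t) ‵+ ‵- (‵s ‵* ‵s)) ⟩
      con a₂ ⊕ ⊝ (var r ⊗ var t) ⊕ ⊝ (var s ⊗ var s)
        ≈⟨ c-⊕-cong (c-⊕-cong (≈sym (rel rel-c)) ≈refl) ≈refl ⟩
      (var r ⊗ var t ⊕ var t ⊗ var r ⊕ var s ⊗ var s) ⊕ ⊝ (var r ⊗ var t) ⊕ ⊝ (var s ⊗ var s)
        ≈⟨ Free.solve free-sound σ σc
             ((‵r ‵* ‵t ‵+ ‵t ‵* ‵r ‵+ ‵s ‵* ‵s) ‵+ ‵- (‵r ‵* ‵t) ‵+ ‵- (‵s ‵* ‵s)) (‵t ‵* ‵r) refl ⟩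
      var t ⊗ var r ∎
      where open Semantics σ
    relations-sound σ σc r t _ ()
    relations-sound σ σc s r _ ()
    relations-sound σ σc s s _ ()
    relations-sound σ σc s t _ ()

    open Reduction relations public using (normalise)

    solve : ∀ {m} (σ : Fin m → Tm GA) → (∀ i → Central (σ i)) →
            ∀ e e′ → normalise e ≡ normalise e′ → Semantics.⟦ σ ⟧ e ≋ Semantics.⟦ σ ⟧ e′
    solve = Reduction.solve relations relations-sound

    solve₀ : ∀ (e e′ : Expr 0) → normalise e ≡ normalise e′ →
             Semantics.⟦ noVariables ⟧ e ≋ Semantics.⟦ noVariables ⟧ e′
    solve₀ = solve noVariables (λ ())

    ξ-central : Central (ξ a₂)
    ξ-central = Central-byGenerators λ
      { r → solve₀ (‵ξ ‵* ‵r) (‵r ‵* ‵ξ) refl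
      ; s → solve₀ (‵ξ ‵* ‵s) (‵s ‵* ‵ξ) refl
      ; t → solve₀ (‵ξ ‵* ‵t) (‵t ‵* ‵ξ) refl }

    η-central : Central η
    η-central = Central-byGenerators λ
      { r → solve₀ (‵η ‵* ‵r) (‵r ‵* ‵η) refl
      ; s → solve₀ (‵η ‵* ‵s) (‵s ‵* ‵η) refl
      ; t → solve₀ (‵η ‵* ‵t) (‵t ‵* ‵η) refl }

    η²≋ξ³+a₂ξ²+a₄ξ+a₆ : η ⊗ η ≋ ξ a₂ ⊗ ξ a₂ ⊗ ξ a₂ ⊕ con a₂ ⊗ ξ a₂ ⊗ ξ a₂ ⊕ con a₄ ⊗ ξ a₂ ⊕ con a₆
    η²≋ξ³+a₂ξ²+a₄ξ+a₆ =
      solve₀ (‵η ‵* ‵η) (‵ξ ‵* ‵ξ ‵* ‵ξ ‵+ ‵a₂ ‵* ‵ξ ‵* ‵ξ ‵+ ‵a₄ ‵* ‵ξ ‵+ ‵a₆) refl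

  module CoordinateRing where
    open PresentedRing K (RelC a₂ a₄ a₆) public

    _≟_ : DecidableEquality GC
    x ≟ x = yes refl
    x ≟ y = no (λ ())
    y ≟ x = no (λ ())
    y ≟ y = yes refl

    rank : GC → ℕ
    rank x = 0
    rank y = 1

    open Normaliser K _≟_ rank coefficient (RelC a₂ a₄ a₆) public

    ‵a₂ ‵a₄ ‵a₆ ‵x ‵y : ∀ {m} → Expr m
    ‵a₂ = atom (coeff (# 0))
    ‵a₄ = atom (coeff (# 1))
    ‵a₆ = atom (coeff (# 2))
    ‵x  = gen x
    ‵y  = gen y

    commutative : ∀ u → Central u
    commutative u v = rel (rel-comm u v)

    relations : Rules
    relations y x = just (Free.normalise (‵x ‵* ‵y))
    relations y y = just (Free.normalise (‵x ‵* ‵x ‵* ‵x ‵+ ‵a₂ ‵* ‵x ‵* ‵x ‵+ ‵a₄ ‵* ‵x ‵+ ‵a₆))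
    relations _ _ = nothing

    relations-sound : SoundRules relations
    relations-sound σ σc y x _ refl =
      ≈trans (Free.normalise-sound free-sound σ σc (‵x ‵* ‵y)) (rel (rel-comm X̂ Ŷ))
    relations-sound σ σc y y _ refl =
      ≈trans (Free.normalise-sound free-sound σ σc
               (‵x ‵* ‵x ‵* ‵x ‵+ ‵a₂ ‵* ‵x ‵* ‵x ‵+ ‵a₄ ‵* ‵x ‵+ ‵a₆))
             (≈sym (rel rel-curve))
    relations-sound σ σc x x _ ()
    relations-sound σ σc x y _ ()

    open Reduction relations public using (normalise)

    solve : ∀ {m} (σ : Fin m → Tm GC) →
            ∀ e e′ → normalise e ≡ normalise e′ → Semantics.⟦ σ ⟧ e ≋ Semantics.⟦ σ ⟧ e′
    solve σ = Reduction.solve relations relations-sound σ (λ i → commutative (σ i))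

    infix 4 _≈M_
    _≈M_ : M2 → M2 → Set (c ⊔ ℓ)
    A ≈M B = A ≈M[ a₂ , a₄ , a₆ ] B

    ≈M-refl : ∀ {A} → A ≈M A
    ≈M-refl = ≈refl , ≈refl , ≈refl , ≈refl

    ≈M-sym : ∀ {A B} → A ≈M B → B ≈M A
    ≈M-sym (e₁₁ , e₁₂ , e₂₁ , e₂₂) = ≈sym e₁₁ , ≈sym e₁₂ , ≈sym e₂₁ , ≈sym e₂₂

    ≈M-trans : ∀ {A B C} → A ≈M B → B ≈M C → A ≈M C
    ≈M-trans (e₁₁ , e₁₂ , e₂₁ , e₂₂) (f₁₁ , f₁₂ , f₂₁ , f₂₂) =
      ≈trans e₁₁ f₁₁ , ≈trans e₁₂ f₁₂ , ≈trans e₂₁ f₂₁ , ≈trans e₂₂ f₂₂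

    +M-cong : ∀ {A A′ B B′} → A ≈M A′ → B ≈M B′ → A +M B ≈M A′ +M B′
    +M-cong (e₁₁ , e₁₂ , e₂₁ , e₂₂) (f₁₁ , f₁₂ , f₂₁ , f₂₂) =
      c-⊕-cong e₁₁ f₁₁ , c-⊕-cong e₁₂ f₁₂ , c-⊕-cong e₂₁ f₂₁ , c-⊕-cong e₂₂ f₂₂

    *M-cong : ∀ {A A′ B B′} → A ≈M A′ → B ≈M B′ → A *M B ≈M A′ *M B′
    *M-cong (e₁₁ , e₁₂ , e₂₁ , e₂₂) (f₁₁ , f₁₂ , f₂₁ , f₂₂) =
      c-⊕-cong (c-⊗-cong e₁₁ f₁₁) (c-⊗-cong e₁₂ f₂₁) , c-⊕-cong (c-⊗-cong e₁₁ f₁₂) (c-⊗-cong e₁₂ f₂₂) ,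
      c-⊕-cong (c-⊗-cong e₂₁ f₁₁) (c-⊗-cong e₂₂ f₂₁) , c-⊕-cong (c-⊗-cong e₂₁ f₁₂) (c-⊗-cong e₂₂ f₂₂)

    -M-cong : ∀ {A A′} → A ≈M A′ → -M A ≈M -M A′
    -M-cong (e₁₁ , e₁₂ , e₂₁ , e₂₂) = ⊝-cong e₁₁ , ⊝-cong e₁₂ , ⊝-cong e₂₁ , ⊝-cong e₂₂

    scal-cong : ∀ {u v} → u ≋ v → scal u ≈M scal v
    scal-cong u≋v = u≋v , ≈refl , ≈refl , u≋v

    record ExprM (m : ℕ) : Set where
      constructor emat
      field e₁₁ e₁₂ e₂₁ e₂₂ : Expr m
    open ExprM

    infixl 6 _‵+M_
    infixl 7 _‵*M_

    _‵+M_ : ∀ {m} → ExprM m → ExprM m → ExprM m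
    emat a b c d ‵+M emat a′ b′ c′ d′ = emat (a ‵+ a′) (b ‵+ b′) (c ‵+ c′) (d ‵+ d′)

    _‵*M_ : ∀ {m} → ExprM m → ExprM m → ExprM m
    emat a b c d ‵*M emat a′ b′ c′ d′ =
      emat (a ‵* a′ ‵+ b ‵* c′) (a ‵* b′ ‵+ b ‵* d′) (c ‵* a′ ‵+ d ‵* c′) (c ‵* b′ ‵+ d ‵* d′)

    ‵-M_ : ∀ {m} → ExprM m → ExprM m
    ‵-M emat a b c d = emat (‵- a) (‵- b) (‵- c) (‵- d)

    ‵scal : ∀ {m} → Expr m → ExprM m
    ‵scal e = emat e ‵0 ‵0 e

    ⟦_⟧M : ∀ {m} → ExprM m → (Fin m → Tm GC) → M2
    ⟦ emat a b c d ⟧M σ = mat (⟦ a ⟧) (⟦ b ⟧) (⟦ c ⟧) (⟦ d ⟧)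
      where open Semantics σ

    normaliseM : ∀ {m} → ExprM m → Poly m × Poly m × Poly m × Poly m
    normaliseM (emat a b c d) = normalise a , normalise b , normalise c , normalise d

    solveM : ∀ {m} (σ : Fin m → Tm GC) (A B : ExprM m) →
             normaliseM A ≡ normaliseM B → ⟦ A ⟧M σ ≈M ⟦ B ⟧M σ
    solveM σ (emat a b c d) (emat a′ b′ c′ d′) eq =
      solve σ a a′ (cong proj₁ eq) , solve σ b b′ (cong (proj₁ ∘ proj₂) eq) ,
      solve σ c c′ (cong (proj₁ ∘ proj₂ ∘ proj₂) eq) , solve σ d d′ (cong (proj₂ ∘ proj₂ ∘ proj₂) eq)

    entries : M2 → M2 → M2 → Fin 12 → Tm GC
    entries A B C = lookup (m11 A ∷ m12 A ∷ m21 A ∷ m22 A ∷ m11 B ∷ m12 B ∷ m21 B ∷ m22 B ∷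
                            m11 C ∷ m12 C ∷ m21 C ∷ m22 C ∷ [])

    ‵A ‵B ‵C : ExprM 12
    ‵A = emat (atom (cvar (# 0))) (atom (cvar (# 1))) (atom (cvar (# 2))) (atom (cvar (# 3)))
    ‵B = emat (atom (cvar (# 4))) (atom (cvar (# 5))) (atom (cvar (# 6))) (atom (cvar (# 7)))
    ‵C = emat (atom (cvar (# 8))) (atom (cvar (# 9))) (atom (cvar (# 10))) (atom (cvar (# 11)))

    +M-assoc : ∀ A B C → (A +M B) +M C ≈M A +M (B +M C)
    +M-assoc A B C = solveM (entries A B C) (‵A ‵+M ‵B ‵+M ‵C) (‵A ‵+M (‵B ‵+M ‵C)) refl

    +M-comm : ∀ A B → A +M B ≈M B +M A
    +M-comm A B = solveM (entries A B B) (‵A ‵+M ‵B) (‵B ‵+M ‵A) refl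

    +M-identityˡ : ∀ A → scal (con 0#) +M A ≈M A
    +M-identityˡ A = solveM (entries A A A) (‵scal ‵0 ‵+M ‵A) ‵A refl

    +M-inverseʳ : ∀ A → A +M (-M A) ≈M scal (con 0#)
    +M-inverseʳ A = solveM (entries A A A) (‵A ‵+M ‵-M ‵A) (‵scal ‵0) refl

    *M-assoc : ∀ A B C → (A *M B) *M C ≈M A *M (B *M C)
    *M-assoc A B C = solveM (entries A B C) (‵A ‵*M ‵B ‵*M ‵C) (‵A ‵*M (‵B ‵*M ‵C)) refl

    *M-identityˡ : ∀ A → scal (con 1#) *M A ≈M A
    *M-identityˡ A = solveM (entries A A A) (‵scal ‵1 ‵*M ‵A) ‵A refl

    *M-identityʳ : ∀ A → A *M scal (con 1#) ≈M A
    *M-identityʳ A = solveM (entries A A A) (‵A ‵*M ‵scal ‵1) ‵A refl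

    *M-distribˡ : ∀ A B C → A *M (B +M C) ≈M (A *M B) +M (A *M C)
    *M-distribˡ A B C = solveM (entries A B C) (‵A ‵*M (‵B ‵+M ‵C)) (‵A ‵*M ‵B ‵+M ‵A ‵*M ‵C) refl

    *M-distribʳ : ∀ A B C → (B +M C) *M A ≈M (B *M A) +M (C *M A)
    *M-distribʳ A B C = solveM (entries A B C) ((‵B ‵+M ‵C) ‵*M ‵A) (‵B ‵*M ‵A ‵+M ‵C ‵*M ‵A) refl

    -- In the environment entries (scal u) (scal v) _, the expressions ‵u and ‵v denote u and v.
    ‵u ‵v : Expr 12
    ‵u = e₁₁ ‵A
    ‵v = e₁₁ ‵B

    scal-+ : ∀ u v → scal (u ⊕ v) ≈M scal u +M scal v
    scal-+ u v = solveM (entries (scal u) (scal v) (scal v)) (‵scal (‵u ‵+ ‵v)) (‵scal ‵u ‵+M ‵scal ‵v) refl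

    scal-* : ∀ u v → scal (u ⊗ v) ≈M scal u *M scal v
    scal-* u v = solveM (entries (scal u) (scal v) (scal v)) (‵scal (‵u ‵* ‵v)) (‵scal ‵u ‵*M ‵scal ‵v) refl

    scal-⊝ : ∀ u → scal (⊝ u) ≈M -M scal u
    scal-⊝ u = solveM (entries (scal u) (scal u) (scal u)) (‵scal (‵- ‵u)) (‵-M ‵scal ‵u) refl

    scal-central : ∀ u A → scal u *M A ≈M A *M scal u
    scal-central u A = solveM (entries (scal u) A A) (‵scal ‵u ‵*M ‵B) (‵B ‵*M ‵scal ‵u) refl

  module Forward where
    open CoordinateRing

    ‵θgen : ∀ {m} → GA → ExprM m
    ‵θgen r = emat (‵- ‵y) (‵x ‵* ‵x ‵+ ‵a₂ ‵* ‵x ‵+ ‵a₄) (‵- ‵x) ‵y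
    ‵θgen s = emat ‵0 (‵x ‵+ ‵a₂) ‵1 ‵0
    ‵θgen t = emat ‵0 ‵1 ‵0 ‵0

    θ-relations : ∀ {u v} → RelA a₂ a₄ a₆ u v → θ a₂ a₄ u ≈M θ a₂ a₄ v
    θ-relations rel-a = solveM noVariables (‵θgen r ‵*M ‵θgen r) (‵scal ‵a₆) refl
    θ-relations rel-b = solveM noVariables (‵θgen r ‵*M ‵θgen s ‵+M ‵θgen s ‵*M ‵θgen r) (‵scal ‵a₄) refl
    θ-relations rel-c = solveM noVariables
      (‵θgen r ‵*M ‵θgen t ‵+M ‵θgen t ‵*M ‵θgen r ‵+M ‵θgen s ‵*M ‵θgen s) (‵scal ‵a₂) refl
    θ-relations rel-d = solveM noVariables (‵θgen s ‵*M ‵θgen t ‵+M ‵θgen t ‵*M ‵θgen s) (‵scal ‵1) refl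
    θ-relations rel-e = solveM noVariables (‵θgen t ‵*M ‵θgen t) (‵scal ‵0) refl

    θ-cong : ∀ {u v} → u ≈A[ a₂ , a₄ , a₆ ] v → θ a₂ a₄ u ≈M θ a₂ a₄ v
    θ-cong (rel ρ)                 = θ-relations ρ
    θ-cong ≈refl                   = ≈M-refl
    θ-cong (≈sym u≈v)              = ≈M-sym (θ-cong u≈v)
    θ-cong (≈trans u≈v v≈w)        = ≈M-trans (θ-cong u≈v) (θ-cong v≈w)
    θ-cong (c-⊕-cong u≈u′ v≈v′)    = +M-cong (θ-cong u≈u′) (θ-cong v≈v′)
    θ-cong (c-⊗-cong u≈u′ v≈v′)    = *M-cong (θ-cong u≈u′) (θ-cong v≈v′)
    θ-cong (⊝-cong u≈u′)           = -M-cong (θ-cong u≈u′)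
    θ-cong (c-⊕-assoc u v w)       = +M-assoc _ _ _
    θ-cong (c-⊕-comm u v)          = +M-comm _ _
    θ-cong (⊕-idˡ u)               = +M-identityˡ _
    θ-cong (⊕-invʳ u)              = +M-inverseʳ _
    θ-cong (c-⊗-assoc u v w)       = *M-assoc _ _ _
    θ-cong (⊗-idˡ u)               = *M-identityˡ _
    θ-cong (⊗-idʳ u)               = *M-identityʳ _
    θ-cong (⊗-distribˡ u v w)      = *M-distribˡ _ _ _
    θ-cong (⊗-distribʳ u v w)      = *M-distribʳ _ _ _
    θ-cong (con-cong k≈l)          = scal-cong (con-cong k≈l)
    θ-cong (con-+ k l)             = ≈M-trans (scal-cong (con-+ k l)) (scal-+ _ _)
    θ-cong (con-* k l)             = ≈M-trans (scal-cong (con-* k l)) (scal-* _ _)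
    θ-cong (con-central k u)       = scal-central _ _

    θ-ξ : θ a₂ a₄ (ξ a₂) ≈M scal X̂
    θ-ξ = solveM noVariables (‵θgen s ‵*M ‵θgen s ‵+M ‵-M ‵scal ‵a₂) (‵scal ‵x) refl

    θ-η : θ a₂ a₄ η ≈M scal Ŷ
    θ-η = solveM noVariables
      (‵θgen r ‵*M ‵θgen s ‵*M ‵θgen t ‵+M ‵-M (‵θgen t ‵*M ‵θgen s ‵*M ‵θgen r)) (‵scal ‵y) refl

  module Backward where
    open Af

    ι : Tm GC → Tm GA
    ι (con k) = con k
    ι (var x) = ξ a₂
    ι (var y) = η
    ι (p ⊕ q) = ι p ⊕ ι q
    ι (p ⊗ q) = ι p ⊗ ι q
    ι (⊝ p)   = ⊝ ι p

    ι-central : ∀ p → Central (ι p)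
    ι-central (con k) = con-central k
    ι-central (var x) = ξ-central
    ι-central (var y) = η-central
    ι-central (p ⊕ q) = Central-⊕ (ι-central p) (ι-central q)
    ι-central (p ⊗ q) = Central-⊗ (ι-central p) (ι-central q)
    ι-central (⊝ p)   = Central-⊝ (ι-central p)

    ι-cong : ∀ {p q} → p ≈C[ a₂ , a₄ , a₆ ] q → ι p ≋ ι q
    ι-cong (rel (rel-comm u v))    = ι-central u (ι v)
    ι-cong (rel rel-curve)         = η²≋ξ³+a₂ξ²+a₄ξ+a₆
    ι-cong ≈refl                   = ≈refl
    ι-cong (≈sym p≈q)              = ≈sym (ι-cong p≈q)
    ι-cong (≈trans p≈q q≈r)        = ≈trans (ι-cong p≈q) (ι-cong q≈r)
    ι-cong (c-⊕-cong p≈p′ q≈q′)    = c-⊕-cong (ι-cong p≈p′) (ι-cong q≈q′)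
    ι-cong (c-⊗-cong p≈p′ q≈q′)    = c-⊗-cong (ι-cong p≈p′) (ι-cong q≈q′)
    ι-cong (⊝-cong p≈p′)           = ⊝-cong (ι-cong p≈p′)
    ι-cong (c-⊕-assoc u v w)       = c-⊕-assoc _ _ _
    ι-cong (c-⊕-comm u v)          = c-⊕-comm _ _
    ι-cong (⊕-idˡ u)               = ⊕-idˡ _
    ι-cong (⊕-invʳ u)              = ⊕-invʳ _
    ι-cong (c-⊗-assoc u v w)       = c-⊗-assoc _ _ _
    ι-cong (⊗-idˡ u)               = ⊗-idˡ _
    ι-cong (⊗-idʳ u)               = ⊗-idʳ _
    ι-cong (⊗-distribˡ u v w)      = ⊗-distribˡ _ _ _
    ι-cong (⊗-distribʳ u v w)      = ⊗-distribʳ _ _ _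
    ι-cong (con-cong k≈l)          = con-cong k≈l
    ι-cong (con-+ k l)             = con-+ k l
    ι-cong (con-* k l)             = con-* k l
    ι-cong (con-central k u)       = con-central k _

    -- θ sends ts, t, sts and st to the matrix units e₁₁, e₁₂, e₂₁ and e₂₂.
    θ⁻¹ : M2 → Tm GA
    θ⁻¹ (mat a b c d) = ι a ⊗ (T̂ ⊗ Ŝ) ⊕ ι b ⊗ T̂ ⊕ ι c ⊗ (Ŝ ⊗ T̂ ⊗ Ŝ) ⊕ ι d ⊗ (Ŝ ⊗ T̂)

    ‵θ⁻¹ : ∀ {m} → Expr m → Expr m → Expr m → Expr m → Expr m
    ‵θ⁻¹ a b c d = a ‵* (‵t ‵* ‵s) ‵+ b ‵* ‵t ‵+ c ‵* (‵s ‵* ‵t ‵* ‵s) ‵+ d ‵* (‵s ‵* ‵t)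

    θ⁻¹-θgen : ∀ g → θ⁻¹ (θgen a₂ a₄ g) ≋ var g
    θ⁻¹-θgen r = solve₀ (‵θ⁻¹ (‵- ‵η) (‵ξ ‵* ‵ξ ‵+ ‵a₂ ‵* ‵ξ ‵+ ‵a₄) (‵- ‵ξ) ‵η) ‵r refl
    θ⁻¹-θgen s = solve₀ (‵θ⁻¹ ‵0 (‵ξ ‵+ ‵a₂) ‵1 ‵0) ‵s refl
    θ⁻¹-θgen t = solve₀ (‵θ⁻¹ ‵0 ‵1 ‵0 ‵0) ‵t refl

    ι-entries : M2 → M2 → Fin 8 → Tm GA
    ι-entries P Q i = ι (lookup (m11 P ∷ m12 P ∷ m21 P ∷ m22 P ∷ m11 Q ∷ m12 Q ∷ m21 Q ∷ m22 Q ∷ []) i)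

    solve-ι : ∀ P Q (e e′ : Expr 8) → normalise e ≡ normalise e′ →
             Semantics.⟦ ι-entries P Q ⟧ e ≋ Semantics.⟦ ι-entries P Q ⟧ e′
    solve-ι P Q = solve (ι-entries P Q) (λ i → ι-central _)

    ‵p₁₁ ‵p₁₂ ‵p₂₁ ‵p₂₂ ‵q₁₁ ‵q₁₂ ‵q₂₁ ‵q₂₂ : Expr 8
    ‵p₁₁ = atom (cvar (# 0))
    ‵p₁₂ = atom (cvar (# 1))
    ‵p₂₁ = atom (cvar (# 2))
    ‵p₂₂ = atom (cvar (# 3))
    ‵q₁₁ = atom (cvar (# 4))
    ‵q₁₂ = atom (cvar (# 5))
    ‵q₂₁ = atom (cvar (# 6))
    ‵q₂₂ = atom (cvar (# 7))

    θ⁻¹-+ : ∀ P Q → θ⁻¹ (P +M Q) ≋ θ⁻¹ P ⊕ θ⁻¹ Q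
    θ⁻¹-+ P Q = solve-ι P Q
      (‵θ⁻¹ (‵p₁₁ ‵+ ‵q₁₁) (‵p₁₂ ‵+ ‵q₁₂) (‵p₂₁ ‵+ ‵q₂₁) (‵p₂₂ ‵+ ‵q₂₂))
      (‵θ⁻¹ ‵p₁₁ ‵p₁₂ ‵p₂₁ ‵p₂₂ ‵+ ‵θ⁻¹ ‵q₁₁ ‵q₁₂ ‵q₂₁ ‵q₂₂) refl

    θ⁻¹-* : ∀ P Q → θ⁻¹ (P *M Q) ≋ θ⁻¹ P ⊗ θ⁻¹ Q
    θ⁻¹-* P Q = solve-ι P Q
      (‵θ⁻¹ (‵p₁₁ ‵* ‵q₁₁ ‵+ ‵p₁₂ ‵* ‵q₂₁) (‵p₁₁ ‵* ‵q₁₂ ‵+ ‵p₁₂ ‵* ‵q₂₂)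
            (‵p₂₁ ‵* ‵q₁₁ ‵+ ‵p₂₂ ‵* ‵q₂₁) (‵p₂₁ ‵* ‵q₁₂ ‵+ ‵p₂₂ ‵* ‵q₂₂))
      (‵θ⁻¹ ‵p₁₁ ‵p₁₂ ‵p₂₁ ‵p₂₂ ‵* ‵θ⁻¹ ‵q₁₁ ‵q₁₂ ‵q₂₁ ‵q₂₂) refl

    θ⁻¹-⊝ : ∀ P → θ⁻¹ (-M P) ≋ ⊝ θ⁻¹ P
    θ⁻¹-⊝ P = solve-ι P P
      (‵θ⁻¹ (‵- ‵p₁₁) (‵- ‵p₁₂) (‵- ‵p₂₁) (‵- ‵p₂₂)) (‵- ‵θ⁻¹ ‵p₁₁ ‵p₁₂ ‵p₂₁ ‵p₂₂) refl

    θ⁻¹-scal : ∀ k → θ⁻¹ (scal (con k)) ≋ con k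
    θ⁻¹-scal k = solve-ι (scal (con k)) (scal (con k)) (‵θ⁻¹ ‵p₁₁ ‵0 ‵0 ‵p₁₁) ‵p₁₁ refl

    θ⁻¹∘θ : ∀ u → θ⁻¹ (θ a₂ a₄ u) ≋ u
    θ⁻¹∘θ (con k) = θ⁻¹-scal k
    θ⁻¹∘θ (var g) = θ⁻¹-θgen g
    θ⁻¹∘θ (u ⊕ v) = ≈trans (θ⁻¹-+ _ _) (c-⊕-cong (θ⁻¹∘θ u) (θ⁻¹∘θ v))
    θ⁻¹∘θ (u ⊗ v) = ≈trans (θ⁻¹-* _ _) (c-⊗-cong (θ⁻¹∘θ u) (θ⁻¹∘θ v))
    θ⁻¹∘θ (⊝ u)   = ≈trans (θ⁻¹-⊝ _) (⊝-cong (θ⁻¹∘θ u))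

    θ⁻¹-cong : ∀ {P Q} → P ≈M[ a₂ , a₄ , a₆ ] Q → θ⁻¹ P ≋ θ⁻¹ Q
    θ⁻¹-cong (a≈a′ , b≈b′ , c≈c′ , d≈d′) =
      c-⊕-cong (c-⊕-cong (c-⊕-cong (c-⊗-cong (ι-cong a≈a′) ≈refl) (c-⊗-cong (ι-cong b≈b′) ≈refl))
                         (c-⊗-cong (ι-cong c≈c′) ≈refl))
               (c-⊗-cong (ι-cong d≈d′) ≈refl)

  open CoordinateRing using (_≈M_; ≈M-refl; ≈M-sym; ≈M-trans; +M-cong; *M-cong; scal-+; scal-*; scal-⊝;
                    emat; ‵scal; _‵+M_; _‵*M_; solveM; entries; ‵A)
  open CoordinateRing.ExprM
  open Forward
  open Backward using (ι; θ⁻¹; θ⁻¹∘θ; θ⁻¹-cong)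

  θ∘ι : ∀ p → θ a₂ a₄ (ι p) ≈M scal p
  θ∘ι (con k) = ≈M-refl
  θ∘ι (var x) = θ-ξ
  θ∘ι (var y) = θ-η
  θ∘ι (p ⊕ q) = ≈M-trans (+M-cong (θ∘ι p) (θ∘ι q)) (≈M-sym (scal-+ p q))
  θ∘ι (p ⊗ q) = ≈M-trans (*M-cong (θ∘ι p) (θ∘ι q)) (≈M-sym (scal-* p q))
  θ∘ι (⊝ p)   = ≈M-trans (CoordinateRing.-M-cong (θ∘ι p)) (≈M-sym (scal-⊝ p))

  θ∘θ⁻¹ : ∀ P → θ a₂ a₄ (θ⁻¹ P) ≈M P
  θ∘θ⁻¹ P = ≈M-trans
    (+M-cong (+M-cong (+M-cong (*M-cong (θ∘ι (m11 P)) ≈M-refl) (*M-cong (θ∘ι (m12 P)) ≈M-refl))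
                      (*M-cong (θ∘ι (m21 P)) ≈M-refl))
             (*M-cong (θ∘ι (m22 P)) ≈M-refl))
    (solveM (entries P P P)
      (‵scal (e₁₁ ‵A) ‵*M (‵θgen t ‵*M ‵θgen s) ‵+M ‵scal (e₁₂ ‵A) ‵*M ‵θgen t ‵+M
       ‵scal (e₂₁ ‵A) ‵*M (‵θgen s ‵*M ‵θgen t ‵*M ‵θgen s) ‵+M ‵scal (e₂₂ ‵A) ‵*M (‵θgen s ‵*M ‵θgen t))
      ‵A refl)

  θ-injective : ∀ u v → θ a₂ a₄ u ≈M θ a₂ a₄ v → u ≈A[ a₂ , a₄ , a₆ ] v
  θ-injective u v θu≈θv = ≈trans (≈sym (θ⁻¹∘θ u)) (≈trans (θ⁻¹-cong θu≈θv) (θ⁻¹∘θ v))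

  θ-surjective : ∀ P → Σ (Tm GA) (λ u → θ a₂ a₄ u ≈M P)
  θ-surjective P = θ⁻¹ P , θ∘θ⁻¹ P

lemma5p2 : ∀ {c ℓ} (K : Field c ℓ) → CharNot2or3 K →
    (a₂ a₄ a₆ : Field.Carrier K) →
    let open FreeAlg K in
    -- θ is well defined on A_f (respects its defining relations) ...
    (∀ u v → u ≈A[ a₂ , a₄ , a₆ ] v → θ a₂ a₄ u ≈M[ a₂ , a₄ , a₆ ] θ a₂ a₄ v) ×
    -- ... injective ...
    (∀ u v → θ a₂ a₄ u ≈M[ a₂ , a₄ , a₆ ] θ a₂ a₄ v → u ≈A[ a₂ , a₄ , a₆ ] v) ×
    -- ... surjective ...
    (∀ (M : M2) → Σ (Tm GA) (λ u → θ a₂ a₄ u ≈M[ a₂ , a₄ , a₆ ] M)) ×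
    -- ... and θ(ξ) = x0 I₂, θ(η) = y0 I₂
    (θ a₂ a₄ (ξ a₂) ≈M[ a₂ , a₄ , a₆ ] scal X̂) ×
    (θ a₂ a₄ η ≈M[ a₂ , a₄ , a₆ ] scal Ŷ)
lemma5p2 K _ a₂ a₄ a₆ = (λ _ _ → θ-cong) , θ-injective , θ-surjective , θ-ξ , θ-η
  where
  open Isomorphism K a₂ a₄ a₆
  open Forward using (θ-cong; θ-ξ; θ-η)
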